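{- Let $G$ be a graph, $\mathcal{T}=(T,\lambda)$ a rooted rank decomposition of $G$, $T_{\mathrm{pref}}$ a leafless prefix of $T$, $k$ a positive integer, and $\mathcal{C}$ a $k$-closure of $T_{\mathrm{pref}}$ that is linked. If $C\in\mathcal{C}$ and $C$ cuts a node $t\in V(T)\setminus T_{\mathrm{pref}}$, then $\mathrm{cutrk}_G(C\cap\mathcal{L}(\mathcal{T})[t])<\mathrm{cutrk}_G(\mathcal{L}(\mathcal{T})[t])$.
   Context: $\mathrm{cutrk}_G(A)$ is the $\mathrm{GF}(2)$-rank of the adjacency matrix between $A$ and $V(G)\setminus A$. A rooted rank decomposition $(T,\lambda)$: $T$ a rooted binary tree (nodes have $0$ or $2$ children, root not a leaf), $\lambda$ a bijection from $V(G)$ to leaves; $\mathcal{L}(\mathcal{T})[t]$ = vertices mapped to leaves descending from $t$ (descendants include $t$). A prefix is a node set inducing a connected subtree containing the root; leafless if it has no leaves; an appendix is a node outside it with a neighbour in it. For a partition $\mathcal{C}$ of $V(G)$, $G[\mathcal{C}]$ keeps only edges between different parts, and the rankwidth of $(G[\mathcal{C}],\mathcal{C})$ is the minimum width of a rank decomposition with leaves in bijection with $\mathcal{C}$ (edge width = $\mathrm{cutrk}_{G[\mathcal{C}]}$ of the union of parts on one side). A $k$-closure of $T_{\mathrm{pref}}$ is a partition $\mathcal{C}$ of $V(G)$ with each part contained in $\mathcal{L}(\mathcal{T})[a]$ for some appendix $a$ and $(G[\mathcal{C}],\mathcal{C})$ of rankwidth at most $2k$. $C$ cuts $t$ if both $\mathcal{L}(\mathcal{T})[t]\cap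 C$ and $\mathcal{L}(\mathcal{T})[t]\setminus C$ are nonempty. $A\subseteq B$ is linked into $B$ if $\mathrm{cutrk}_G(A)\le\mathrm{cutrk}_G(S)$ for all $A\subseteq S\subseteq B$. The closure is linked if for every $C\in\mathcal{C}$ with $C\subseteq\mathcal{L}(\mathcal{T})[a]$ for an appendix $a$: $C$ is linked into $\mathcal{L}(\mathcal{T})[a]$, and whenever $C$ cuts a descendant $t$ of $a$, $\mathrm{cutrk}_G(C\cup\mathcal{L}(\mathcal{T})[t])>\mathrm{cutrk}_G(C)$. -}

module Defs where

open import Data.Bool using (Bool; true; false; _∧_; _∨_; not; _xor_; if_then_else_)
open import Data.Nat using (ℕ; zero; suc; _≤_; _<_; _⊔_; _*_)
open import Data.Fin using (Fin; zero; suc; _≟_)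
open import Data.Fin.Subset using (Subset; _∈_; _⊆_; _∩_; _∪_; ∁; ∣_∣; Nonempty; ⁅_⁆; ⊥)
open import Data.Vec using (Vec; []; _∷_; tabulate; lookup)
open import Data.List using (List; []; _∷_; _∷ʳ_; _++_; map; foldr; allFin)
open import Data.List.Relation.Binary.Permutation.Propositional using (_↭_)
open import Data.Maybe using (Maybe; just; nothing; maybe)
open import Data.Product using (Σ; ∃; ∃-syntax; _×_; _,_)
open import Data.Sum using (_⊎_)
open import Relation.Nullary using (¬_; does)
open import Relation.Binary.PropositionalEquality using (_≡_)

record Graph (n : ℕ) : Set where
  field
    adj    : Fin n → Fin n → Bool
    sym    : ∀ i j → adj i j ≡ adj j i
    irrefl : ∀ i → adj i i ≡ false
open Graph public

parity : ∀ {n} → (Fin n → Bool) → Bool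
parity {zero}  f = false
parity {suc n} f = f zero xor parity (λ i → f (suc i))

allSubsets : ∀ n → List (Subset n)
allSubsets zero    = [] ∷ []
allSubsets (suc n) = map (true ∷_) (allSubsets n) ++ map (false ∷_) (allSubsets n)

anyᵇ : ∀ {n} → (Fin n → Bool) → Bool
anyᵇ {zero}  f = false
anyᵇ {suc n} f = f zero ∨ anyᵇ (λ i → f (suc i))

allᵇ : ∀ {n} → (Fin n → Bool) → Bool
allᵇ f = not (anyᵇ (λ i → not (f i)))

subsetᵇ : ∀ {n} → Subset n → Subset n → Bool
subsetᵇ S T = allᵇ (λ i → not (lookup S i) ∨ lookup T i)

nonemptyᵇ : ∀ {n} → Subset n → Bool
nonemptyᵇ S = anyᵇ (lookup S)

allL : ∀ {A : Set} → (A → Bool) → List A → Bool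
allL p = foldr (λ x b → p x ∧ b) true

filterL : ∀ {A : Set} → (A → Bool) → List A → List A
filterL p = foldr (λ x xs → if p x then x ∷ xs else xs) []

maxList : List ℕ → ℕ
maxList = foldr _⊔_ 0

combination : ∀ {r c} → (Fin r → Fin c → Bool) → Subset r → Fin c → Bool
combination M T j = parity (λ i → lookup T i ∧ M i j)

independentᵇ : ∀ {r c} → (Fin r → Fin c → Bool) → Subset r → Bool
independentᵇ {r} M S =
  allL (λ T → not (subsetᵇ T S ∧ nonemptyᵇ T) ∨ anyᵇ (combination M T)) (allSubsets r)

rankGF2 : ∀ {r c} → (Fin r → Fin c → Bool) → ℕ
rankGF2 {r} M = maxList (map ∣_∣ (filterL (independentᵇ M) (allSubsets r)))

-- cutrk_G(A): GF(2)-rank of the A × (V(G) ∖ A) adjacency matrix.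
-- Rows outside A and columns inside A are zeroed, which does not change the rank.
cutrk : ∀ {n} → Graph n → Subset n → ℕ
cutrk G A = rankGF2 (λ i j → lookup A i ∧ (adj G i j ∧ not (lookup A j)))

-- Rooted binary trees with labelled leaves; nodes are addressed by
-- paths from the root (false = left child, true = right child).

data BTree (A : Set) : Set where
  leaf : A → BTree A
  node : BTree A → BTree A → BTree A

Path : Set
Path = List Bool

subAt : ∀ {A} → BTree A → Path → Maybe (BTree A)
subAt t            []           = just t
subAt (leaf _)     (_ ∷ _)      = nothing
subAt (node l r)   (false ∷ p)  = subAt l p
subAt (node l r)   (true ∷ p)   = subAt r p

leaves : ∀ {A} → BTree A → List A
leaves (leaf a)   = a ∷ []
leaves (node l r) = leaves l ++ leaves r

IsNode : ∀ {A} → BTree A → Path → Set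
IsNode T p = ∃[ t ] (subAt T p ≡ just t)

IsLeaf : ∀ {A} → BTree A → Path → Set
IsLeaf T p = ∃[ a ] (subAt T p ≡ just (leaf a))

ChildOf : Path → Path → Set
ChildOf q p = ∃[ b ] (q ≡ p ∷ʳ b)

TreeAdj : Path → Path → Set
TreeAdj p q = ChildOf q p ⊎ ChildOf p q

-- d is a descendant of a (descendants include a itself)
DescendantOf : ∀ {A} → BTree A → Path → Path → Set
DescendantOf T d a = IsNode T d × ∃[ r ] (d ≡ a ++ r)

leafSet : ∀ {n} → BTree (Fin n) → Subset n
leafSet t = foldr (λ v S → ⁅ v ⁆ ∪ S) ⊥ (leaves t)

L : ∀ {n} → BTree (Fin n) → Path → Subset n
L T p = maybe leafSet ⊥ (subAt T p)

record RootedRankDecomposition {n : ℕ} (G : Graph n) : Set where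
  field
    tree        : BTree (Fin n)
    rootNotLeaf : ∃[ l ] ∃[ r ] (tree ≡ node l r)
    -- λ is a bijection V(G) → leaves: each vertex labels exactly one leaf
    bijective   : leaves tree ↭ allFin n
open RootedRankDecomposition public

record IsPrefix {A : Set} (T : BTree A) (P : Path → Set) : Set where
  field
    nodes     : ∀ p → P p → IsNode T p
    hasRoot   : P []
    -- connected subtree containing the root = closed under parents
    parentIn  : ∀ p b → P (p ∷ʳ b) → P p

Leafless : ∀ {A} → BTree A → (Path → Set) → Set
Leafless T P = ∀ p → P p → ¬ IsLeaf T p

Appendix : ∀ {A} → BTree A → (Path → Set) → Path → Set
Appendix T P a = IsNode T a × ¬ P a × ∃[ q ] (P q × TreeAdj a q)

-- Partitions of V(G): a surjective labelling f : Fin n → Fin m;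
-- the parts are the fibres of f.

Surjective : ∀ {n m} → (Fin n → Fin m) → Set
Surjective {n} {m} f = ∀ (i : Fin m) → ∃[ v ] (f v ≡ i)

part : ∀ {n m} → (Fin n → Fin m) → Fin m → Subset n
part f i = tabulate (λ v → does (f v ≟ i))

-- G[𝒞]: keep only edges between different parts
quotientGraph : ∀ {n m} → Graph n → (Fin n → Fin m) → Graph n
quotientGraph G f = record
  { adj    = λ i j → adj G i j ∧ not (does (f i ≟ f j))
  ; sym    = symm
  ; irrefl = irr
  }
  where
  open import Relation.Binary.PropositionalEquality using (cong₂; refl)
  open import Relation.Nullary using (yes; no)
  open import Data.Bool.Properties using (∧-zeroʳ)
  symm : ∀ i j → (adj G i j ∧ not (does (f i ≟ f j))) ≡ (adj G j i ∧ not (does (f j ≟ f i)))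
  symm i j with f i ≟ f j | f j ≟ f i
  ... | yes _ | yes _ = cong₂ _∧_ (Graph.sym G i j) refl
  ... | no  _ | no  _ = cong₂ _∧_ (Graph.sym G i j) refl
  ... | yes e | no ne = Data.Empty.⊥-elim (ne (Relation.Binary.PropositionalEquality.sym e))
    where import Data.Empty
  ... | no ne | yes e = Data.Empty.⊥-elim (ne (Relation.Binary.PropositionalEquality.sym e))
    where import Data.Empty
  irr : ∀ i → (adj G i i ∧ not (does (f i ≟ f i))) ≡ false
  irr i with f i ≟ f i
  ... | yes _ = ∧-zeroʳ (adj G i i)
  ... | no ne = Data.Empty.⊥-elim (ne refl)
    where import Data.Empty

unionParts : ∀ {n m} → (Fin n → Fin m) → Subset m → Subset n
unionParts f I = tabulate (λ v → lookup I (f v))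

-- (G[𝒞], 𝒞) has rankwidth at most w: there is a rank decomposition
-- whose leaves are in bijection with the parts, all of whose edge
-- cuts have cutrk_{G[𝒞]} at most w.  (Rooted form: the cut of every
-- node of a rooted binary tree.)
RankwidthAtMost : ∀ {n m} → Graph n → (Fin n → Fin m) → ℕ → Set
RankwidthAtMost {n} {m} G f w =
  ∃[ D ] ((leaves D ↭ allFin m) ×
          (∀ p → (t : BTree (Fin m)) → subAt D p ≡ just t →
             cutrk (quotientGraph G f) (unionParts f (leafSet t)) ≤ w))

IsKClosure : ∀ {n m} (G : Graph n) → RootedRankDecomposition G → (Path → Set) →
             ℕ → (Fin n → Fin m) → Set
IsKClosure G 𝒯 P k f =
  Surjective f ×
  (∀ i → ∃[ a ] (Appendix (tree 𝒯) P a × part f i ⊆ L (tree 𝒯) a)) ×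
  RankwidthAtMost G f (2 * k)

Cuts : ∀ {n} → BTree (Fin n) → Subset n → Path → Set
Cuts T C t = Nonempty (L T t ∩ C) × Nonempty (L T t ∩ ∁ C)

LinkedInto : ∀ {n} → Graph n → Subset n → Subset n → Set
LinkedInto G A B = A ⊆ B × (∀ S → A ⊆ S → S ⊆ B → cutrk G A ≤ cutrk G S)

IsLinkedClosure : ∀ {n m} (G : Graph n) → RootedRankDecomposition G → (Path → Set) →
                  (Fin n → Fin m) → Set
IsLinkedClosure G 𝒯 P f =
  ∀ i a → Appendix (tree 𝒯) P a → part f i ⊆ L (tree 𝒯) a →
    LinkedInto G (part f i) (L (tree 𝒯) a) ×
    (∀ t → DescendantOf (tree 𝒯) t a → Cuts (tree 𝒯) (part f i) t →
       cutrk G (part f i) < cutrk G (part f i ∪ L (tree 𝒯) t))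

{-# OPTIONS --safe #-}

-- C lies in L[a] for an appendix a and meets L[t]. Leaf sets of incomparable nodes are
-- disjoint and every proper ancestor of an appendix lies in the prefix, so t is a descendant
-- of a, and linkedness gives cutrk(C) < cutrk(C ∪ L[t]). Submodularity of the cut-rank,
--   cutrk(C ∩ L[t]) + cutrk(C ∪ L[t]) ≤ cutrk(C) + cutrk(L[t]),
-- then yields the claim.
--
-- Submodularity of the cut-rank comes from the matrix M obtained by stacking the adjacency
-- matrix on the identity: the rows of M indexed by the two copies of X have rank
-- cutrk(X) + |X|, so the cut-rank inherits submodularity from the rank function of the
-- GF(2) vector matroid of M, which rests on the Steinitz exchange lemma.

module Submission where

open import Defs hiding (sym)

open import Algebra.Bundles using (CommutativeRing)
open import Data.Bool using (Bool; true; false; _∧_; _∨_; not; _xor_; if_then_else_)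
open import Data.Bool.Properties
  using (∧-assoc; ∧-comm; ∧-identityʳ; ∧-zeroʳ; ∧-distribʳ-xor; xor-assoc; xor-identityʳ; xor-same;
         xor-∧-commutativeRing)
open import Data.Empty using (⊥; ⊥-elim)
open import Data.Fin using (Fin; zero; suc; _≟_; _↑ˡ_; _↑ʳ_; splitAt)
open import Data.Fin.Properties using (suc-injective; splitAt⁻¹-↑ˡ; splitAt⁻¹-↑ʳ)
open import Data.Fin.Subset using (Subset; ∣_∣; _∩_; _∪_; ⁅_⁆) renaming (_∈_ to _∈ₛ_; ⊥ to ∅)
open import Data.Fin.Subset.Properties using (x∈p∩q⁻; x∈p∪q⁻; x∈⁅y⁆⇒x≡y; ∉⊥)
open import Data.List using (List; []; _∷_; _∷ʳ_; map; foldr; _++_; allFin)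
open import Data.List.Properties using (++-assoc; ++-identityʳ; ∷ʳ-injectiveˡ)
open import Data.List.Membership.Propositional using (_∈_)
open import Data.List.Membership.Propositional.Properties using (∈-map⁺; ∈-map⁻; ∈-++⁺ˡ; ∈-++⁺ʳ; ∈-allFin)
open import Data.List.Relation.Binary.Permutation.Propositional using (↭-sym; ↭⇒↭ₛ)
open import Data.List.Relation.Binary.Permutation.Setoid.Properties using (Unique-resp-↭)
open import Data.List.Relation.Unary.All as All using ()
open import Data.List.Relation.Unary.All.Properties using (++⁻ˡ; ++⁻ʳ)
open import Data.List.Relation.Unary.AllPairs using ([]; _∷_)
open import Data.List.Relation.Unary.Any using (here; there)
open import Data.List.Relation.Unary.Unique.Propositional using (Unique)
open import Data.List.Relation.Unary.Unique.Propositional.Properties using (allFin⁺)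
open import Data.Maybe using (just; nothing; maybe)
open import Data.Nat using (ℕ; zero; suc; pred; _+_; _≤_; _<_; z≤n; s≤s)
open import Data.Nat.Properties
  using (<-irrefl; ≤-trans; ≤-reflexive; n≤1+n; m≤m⊔n; m≤n⊔m; ⊔-sel; +-suc; +-assoc; +-comm;
         +-mono-≤; +-monoʳ-<; +-cancelʳ-≤; +-cancelʳ-<; +-commutativeSemigroup; module ≤-Reasoning)
open import Data.Product using (∃-syntax; _×_; _,_; proj₁; proj₂)
open import Data.Sum using (_⊎_; inj₁; inj₂)
open import Data.Vec using (Vec; []; _∷_; lookup; tabulate)
open import Data.Vec.Properties using (lookup∘tabulate; tabulate∘lookup; lookup-zipWith)
open import Data.Vec.Functional using () renaming (_++_ to _++ᶠ_)
open import Data.Vec.Functional.Properties using (lookup-++ˡ; lookup-++ʳ)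
open import Function using (_∘_)
open import Relation.Nullary using (¬_; does; yes; no)
open import Relation.Nullary.Decidable using (dec-true; dec-false)
open import Relation.Binary.PropositionalEquality
  using (_≡_; _≢_; _≗_; refl; sym; trans; cong; cong₂; subst; subst₂; setoid; module ≡-Reasoning)

open import Algebra.Properties.CommutativeSemigroup
  (CommutativeRing.+-commutativeSemigroup xor-∧-commutativeRing)
  using () renaming (interchange to xor-interchange)
open import Algebra.Properties.CommutativeSemigroup +-commutativeSemigroup
  using () renaming (interchange to +-interchange)

Bits : ℕ → Set
Bits N = Fin N → Bool

module _ {N : ℕ} where

  _⊆_ : Bits N → Bits N → Set
  S ⊆ T = ∀ i → S i ≡ true → T i ≡ true

  Inhabited : Bits N → Set
  Inhabited S = ∃[ i ] S i ≡ true

  Empty : Bits N → Set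
  Empty S = ∀ i → S i ≡ false

  _[_]≔_ : Bits N → Fin N → Bool → Bits N
  (S [ k ]≔ b) i = if does (i ≟ k) then b else S i

  _∩ᵇ_ : Bits N → Bits N → Bits N
  (S ∩ᵇ T) i = S i ∧ T i

  _∪ᵇ_ : Bits N → Bits N → Bits N
  (S ∪ᵇ T) i = S i ∨ T i

  singleton : Fin N → Bits N
  singleton k i = does (i ≟ k)

card : ∀ {N} → Bits N → ℕ
card {zero}  S = 0
card {suc N} S = (if S zero then 1 else 0) + card (S ∘ suc)

module _ {N : ℕ} (S : Bits N) (k : Fin N) (b : Bool) where

  []≔-updates : (S [ k ]≔ b) k ≡ b
  []≔-updates rewrite dec-true (k ≟ k) refl = refl

  []≔-minimal : ∀ {i} → i ≢ k → (S [ k ]≔ b) i ≡ S i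
  []≔-minimal {i} i≢k rewrite dec-false (i ≟ k) i≢k = refl

singleton-inhabited : ∀ {N} (k : Fin N) → Inhabited (singleton k)
singleton-inhabited k = k , dec-true (k ≟ k) refl

singleton-⊆ : ∀ {N} {S : Bits N} {k} → S k ≡ true → singleton k ⊆ S
singleton-⊆ {k = k} Sk i e with i ≟ k
... | yes refl = Sk

≡true⇒≢false : ∀ {b : Bool} → b ≡ true → b ≢ false
≡true⇒≢false refl ()

x∧y≡true⇒x≡true : ∀ {x y} → x ∧ y ≡ true → x ≡ true
x∧y≡true⇒x≡true {true} _ = refl

x∧y≡true⇒y≡true : ∀ {x y} → x ∧ y ≡ true → y ≡ true
x∧y≡true⇒y≡true {true} y≡true = y≡true

[]≔false-⊆ : ∀ {N} (S : Bits N) k → (S [ k ]≔ false) ⊆ S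
[]≔false-⊆ S k i e with i ≟ k
... | no _ = e

⊆-[]≔false : ∀ {N} {S B : Bits N} {k} → S ⊆ B → S k ≡ false → S ⊆ (B [ k ]≔ false)
⊆-[]≔false {k = k} S⊆B Sk i Si with i ≟ k
... | yes refl = ⊥-elim (≡true⇒≢false Si Sk)
... | no _ = S⊆B i Si

⊆-[]≔true : ∀ {N} (S : Bits N) k → S ⊆ (S [ k ]≔ true)
⊆-[]≔true S k i Si with i ≟ k
... | yes _ = refl
... | no _  = Si

[]≔true-⊆ : ∀ {N} {S U : Bits N} {k} → S ⊆ U → U k ≡ true → (S [ k ]≔ true) ⊆ U
[]≔true-⊆ {k = k} S⊆U Uk i e with i ≟ k
... | yes refl = Uk
... | no _     = S⊆U i e

⊆[]≔true⇒⊆ : ∀ {N} {S J : Bits N} {k} → S ⊆ (J [ k ]≔ true) → S k ≡ false → S ⊆ J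
⊆[]≔true⇒⊆ {J = J} {k} S⊆J+k Sk i Si with i ≟ k
... | yes refl = ⊥-elim (≡true⇒≢false Si Sk)
... | no i≢k   = trans (sym ([]≔-minimal J k true i≢k)) (S⊆J+k i Si)

∩ᵇ⊆∪ᵇ : ∀ {N} {S T : Bits N} → (S ∩ᵇ T) ⊆ (S ∪ᵇ T)
∩ᵇ⊆∪ᵇ {S = S} i e with S i
... | true = refl

⊆∪ᵇ⇒≗∩ᵇ∪ᵇ∩ᵇ : ∀ {N} {J S T : Bits N} → J ⊆ (S ∪ᵇ T) → J ≗ ((J ∩ᵇ S) ∪ᵇ (J ∩ᵇ T))
⊆∪ᵇ⇒≗∩ᵇ∪ᵇ∩ᵇ {J = J} {S} {T} J⊆S∪T i with J i in Ji
... | false = refl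
... | true with S i | T i | J⊆S∪T i Ji
...   | true  | _    | _ = refl
...   | false | true | _ = refl

inhabited-or-empty : ∀ {N} (S : Bits N) → Inhabited S ⊎ Empty S
inhabited-or-empty {zero} S = inj₂ (λ ())
inhabited-or-empty {suc N} S with S zero in eq
... | true = inj₁ (zero , eq)
... | false with inhabited-or-empty (S ∘ suc)
...   | inj₁ (i , e) = inj₁ (suc i , e)
...   | inj₂ h = inj₂ λ { zero → eq ; (suc i) → h i }

parity-cong : ∀ {n} {f g : Fin n → Bool} → f ≗ g → parity f ≡ parity g
parity-cong {zero}  f≗g = refl
parity-cong {suc n} f≗g = cong₂ _xor_ (f≗g zero) (parity-cong (f≗g ∘ suc))

parity-xor : ∀ {n} (f g : Fin n → Bool) → parity (λ i → f i xor g i) ≡ parity f xor parity g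
parity-xor {zero}  f g = refl
parity-xor {suc n} f g = begin
  (f zero xor g zero) xor parity (λ i → f (suc i) xor g (suc i))
    ≡⟨ cong ((f zero xor g zero) xor_) (parity-xor (f ∘ suc) (g ∘ suc)) ⟩
  (f zero xor g zero) xor (parity (f ∘ suc) xor parity (g ∘ suc))
    ≡⟨ xor-interchange (f zero) (g zero) _ _ ⟩
  (f zero xor parity (f ∘ suc)) xor (g zero xor parity (g ∘ suc)) ∎
  where open ≡-Reasoning

parity-empty : ∀ {n} {f : Fin n → Bool} → Empty f → parity f ≡ false
parity-empty {zero}  f-empty = refl
parity-empty {suc n} f-empty rewrite f-empty zero = parity-empty (f-empty ∘ suc)

parity-∧ʳ : ∀ {n} (f : Fin n → Bool) c → parity (λ i → f i ∧ c) ≡ parity f ∧ c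
parity-∧ʳ {zero}  f c = refl
parity-∧ʳ {suc n} f c =
  trans (cong ((f zero ∧ c) xor_) (parity-∧ʳ (f ∘ suc) c))
        (sym (∧-distribʳ-xor c (f zero) (parity (f ∘ suc))))

parity-∧ˡ : ∀ {n} c (f : Fin n → Bool) → parity (λ i → c ∧ f i) ≡ c ∧ parity f
parity-∧ˡ c f = begin
  parity (λ i → c ∧ f i) ≡⟨ parity-cong (λ i → ∧-comm c (f i)) ⟩
  parity (λ i → f i ∧ c) ≡⟨ parity-∧ʳ f c ⟩
  parity f ∧ c           ≡⟨ ∧-comm _ c ⟩
  c ∧ parity f           ∎
  where open ≡-Reasoning

parity-supported-at : ∀ {n} (f : Fin n → Bool) k → (∀ i → i ≢ k → f i ≡ false) → parity f ≡ f k
parity-supported-at f zero    off-k =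
  trans (cong (f zero xor_) (parity-empty (λ i → off-k (suc i) λ ()))) (xor-identityʳ (f zero))
parity-supported-at f (suc k) off-k rewrite off-k zero (λ ()) =
  parity-supported-at (f ∘ suc) k (λ i i≢k → off-k (suc i) (i≢k ∘ suc-injective))

parity-split : ∀ n m (f : Fin (n + m) → Bool) →
               parity f ≡ parity (λ i → f (i ↑ˡ m)) xor parity (λ j → f (n ↑ʳ j))
parity-split zero    m f = refl
parity-split (suc n) m f =
  trans (cong (f zero xor_) (parity-split n m (f ∘ suc))) (sym (xor-assoc (f zero) _ _))

card-cong : ∀ {N} {S T : Bits N} → S ≗ T → card S ≡ card T
card-cong {zero}  S≗T = refl
card-cong {suc N} S≗T = cong₂ _+_ (cong (λ b → if b then 1 else 0) (S≗T zero)) (card-cong (S≗T ∘ suc))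

card-split : ∀ n m (S : Bits (n + m)) → card S ≡ card (λ i → S (i ↑ˡ m)) + card (λ j → S (n ↑ʳ j))
card-split zero    m S = refl
card-split (suc n) m S =
  trans (cong ((if S zero then 1 else 0) +_) (card-split n m (S ∘ suc)))
        (sym (+-assoc (if S zero then 1 else 0) _ _))

card-empty : ∀ {N} {S : Bits N} → Empty S → card S ≡ 0
card-empty {zero}  S-empty = refl
card-empty {suc N} S-empty rewrite S-empty zero = card-empty (S-empty ∘ suc)

card≡0⇒empty : ∀ {N} (S : Bits N) → card S ≡ 0 → Empty S
card≡0⇒empty {suc N} S eq i with S zero in S0
card≡0⇒empty {suc N} S eq zero    | false = S0
card≡0⇒empty {suc N} S eq (suc i) | false = card≡0⇒empty (S ∘ suc) eq i

card≡suc⇒inhabited : ∀ {N m} (S : Bits N) → card S ≡ suc m → Inhabited S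
card≡suc⇒inhabited S eq with inhabited-or-empty S
... | inj₁ S-inhabited = S-inhabited
... | inj₂ S-empty with trans (sym eq) (card-empty S-empty)
...   | ()

card-mono : ∀ {N} {S T : Bits N} → S ⊆ T → card S ≤ card T
card-mono {zero} S⊆T = z≤n
card-mono {suc N} {S} {T} S⊆T with S zero in S0 | T zero in T0
... | true  | true  = s≤s (card-mono (S⊆T ∘ suc))
... | false | true  = ≤-trans (card-mono (S⊆T ∘ suc)) (n≤1+n _)
... | false | false = card-mono (S⊆T ∘ suc)
... | true  | false with trans (sym (S⊆T zero S0)) T0
...   | ()

card-insert : ∀ {N} (S : Bits N) k → S k ≡ false → card (S [ k ]≔ true) ≡ suc (card S)
card-insert {suc N} S zero    Sk rewrite Sk = refl
card-insert {suc N} S (suc k) Sk with S zero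
... | true  = cong suc (card-insert (S ∘ suc) k Sk)
... | false = card-insert (S ∘ suc) k Sk

card-remove : ∀ {N} (S : Bits N) k → S k ≡ true → card S ≡ suc (card (S [ k ]≔ false))
card-remove {suc N} S zero    Sk rewrite Sk = refl
card-remove {suc N} S (suc k) Sk with S zero
... | true  = cong suc (card-remove (S ∘ suc) k Sk)
... | false = card-remove (S ∘ suc) k Sk

card-∪-∩ : ∀ {N} (S T : Bits N) → card (S ∪ᵇ T) + card (S ∩ᵇ T) ≡ card S + card T
card-∪-∩ {zero} S T = refl
card-∪-∩ {suc N} S T with S zero | T zero | card-∪-∩ (S ∘ suc) (T ∘ suc)
... | true  | true  | ih = cong suc (trans (+-suc _ _) (trans (cong suc ih) (sym (+-suc _ _))))
... | true  | false | ih = cong suc ih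
... | false | true  | ih = trans (cong suc ih) (sym (+-suc _ _))
... | false | false | ih = ih

-- Linear combinations over GF(2)

Matrix : ℕ → ℕ → Set
Matrix r c = Fin r → Fin c → Bool

linComb : ∀ {r c} → Matrix r c → Bits r → Bits c
linComb v T j = parity (λ i → T i ∧ v i j)

Independent : ∀ {r c} → Matrix r c → Bits r → Set
Independent v S = ∀ T → T ⊆ S → Inhabited T → ¬ Empty (linComb v T)

Dependent : ∀ {r c} → Matrix r c → Bits r → Set
Dependent v S = ∃[ T ] (T ⊆ S × Inhabited T × Empty (linComb v T))

InSpan : ∀ {r c} → Matrix r c → Bits r → Bits c → Set
InSpan v B u = ∃[ T ] (T ⊆ B × linComb v T ≗ u)

record IsRank {r c} (v : Matrix r c) (S : Bits r) (ρ : ℕ) : Set where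
  field
    upper             : ∀ K → K ⊆ S → Independent v K → card K ≤ ρ
    basis             : Bits r
    basis⊆            : basis ⊆ S
    basis-independent : Independent v basis
    card-basis        : card basis ≡ ρ

IsRank-cong : ∀ {N c} {v : Matrix N c} {S S′ ρ} → S ≗ S′ → IsRank v S ρ → IsRank v S′ ρ
IsRank-cong S≗S′ R = record
  { upper             = λ K K⊆S′ → upper K (λ i Ki → trans (S≗S′ i) (K⊆S′ i Ki))
  ; basis             = basis
  ; basis⊆            = λ i Bi → trans (sym (S≗S′ i)) (basis⊆ i Bi)
  ; basis-independent = basis-independent
  ; card-basis        = card-basis
  }
  where open IsRank R

module _ {r c : ℕ} (v : Matrix r c) where

  linComb-cong : ∀ {S T} → S ≗ T → linComb v S ≗ linComb v T
  linComb-cong S≗T j = parity-cong (λ i → cong (_∧ v i j) (S≗T i))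

  linComb-xor : ∀ S T j → linComb v (λ i → S i xor T i) j ≡ linComb v S j xor linComb v T j
  linComb-xor S T j =
    trans (parity-cong (λ i → ∧-distribʳ-xor (v i j) (S i) (T i))) (parity-xor (λ i → S i ∧ v i j) _)

  linComb-∧ˡ : ∀ b T j → linComb v (λ i → b ∧ T i) j ≡ b ∧ linComb v T j
  linComb-∧ˡ b T j = trans (parity-cong (λ i → ∧-assoc b (T i) (v i j))) (parity-∧ˡ b (λ i → T i ∧ v i j))

  linComb-empty : ∀ {T} → Empty T → Empty (linComb v T)
  linComb-empty T-empty j = parity-empty (λ i → cong (_∧ v i j) (T-empty i))

  linComb-singleton : ∀ k → linComb v (singleton k) ≗ v k
  linComb-singleton k j =
    trans (parity-supported-at _ k (λ i i≢k → cong (_∧ v i j) (dec-false (i ≟ k) i≢k)))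
          (cong (_∧ v k j) (dec-true (k ≟ k) refl))

  linComb-[]≔ : ∀ T k b → T k ≡ false → ∀ j → linComb v (T [ k ]≔ b) j ≡ linComb v T j xor (b ∧ v k j)
  linComb-[]≔ T k b Tk j = begin
    linComb v (T [ k ]≔ b) j
      ≡⟨ linComb-cong []≔-as-xor j ⟩
    linComb v (λ i → T i xor (b ∧ singleton k i)) j
      ≡⟨ linComb-xor T _ j ⟩
    linComb v T j xor linComb v (λ i → b ∧ singleton k i) j
      ≡⟨ cong (linComb v T j xor_) (linComb-∧ˡ b (singleton k) j) ⟩
    linComb v T j xor (b ∧ linComb v (singleton k) j)
      ≡⟨ cong (λ x → linComb v T j xor (b ∧ x)) (linComb-singleton k j) ⟩
    linComb v T j xor (b ∧ v k j) ∎
    where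
    open ≡-Reasoning
    []≔-as-xor : (T [ k ]≔ b) ≗ (λ i → T i xor (b ∧ singleton k i))
    []≔-as-xor i with i ≟ k
    ... | yes refl rewrite Tk = sym (∧-identityʳ b)
    ... | no _ = sym (trans (cong (T i xor_) (∧-zeroʳ b)) (xor-identityʳ (T i)))

  independent-antimono : ∀ {S T} → Independent v S → T ⊆ S → Independent v T
  independent-antimono S-indep T⊆S U U⊆T = S-indep U (λ i → T⊆S i ∘ U⊆T i)

  independent⇒row-nonzero : ∀ {S k} → Independent v S → S k ≡ true → ¬ Empty (v k)
  independent⇒row-nonzero {k = k} S-indep Sk vk-empty =
    S-indep (singleton k) (singleton-⊆ Sk) (singleton-inhabited k)
            (λ j → trans (linComb-singleton k j) (vk-empty j))

  inSpan-mono : ∀ {B B′ u} → B ⊆ B′ → InSpan v B u → InSpan v B′ u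
  inSpan-mono B⊆B′ (T , T⊆B , T↦u) = T , (λ i → B⊆B′ i ∘ T⊆B i) , T↦u

  inSpan-row : ∀ {B} k → B k ≡ true → InSpan v B (v k)
  inSpan-row k Bk = singleton k , singleton-⊆ Bk , linComb-singleton k

  inSpan-empty : ∀ {B u} → Empty B → InSpan v B u → Empty u
  inSpan-empty B-empty (T , T⊆B , T↦u) j = trans (sym (T↦u j)) (linComb-empty T-empty j)
    where
    T-empty : Empty T
    T-empty i with T i in Ti
    ... | false = refl
    ... | true with trans (sym (T⊆B i Ti)) (B-empty i)
    ...   | ()

linComb-identity : ∀ {N} (B : Bits N) → linComb (λ i → singleton i) B ≗ B
linComb-identity B j =
  trans (parity-supported-at _ j off-diagonal) (trans (cong (B j ∧_) (dec-true (j ≟ j) refl)) (∧-identityʳ (B j)))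
  where
  off-diagonal : ∀ i → i ≢ j → B i ∧ singleton i j ≡ false
  off-diagonal i i≢j = trans (cong (B i ∧_) (dec-false (j ≟ i) (i≢j ∘ sym))) (∧-zeroʳ (B i))

-- Steinitz exchange

-- Gaussian elimination of the coordinate j₀ of B, using the row i₀ of K as pivot,
-- where T i is a representation of row i over B.
module Elimination {a b c} (ks : Matrix a c) (K : Bits a) (bs : Matrix b c) (B : Bits b)
  (T : Fin a → Bits b) (T⊆B : ∀ i → T i ⊆ B) (T↦ks : ∀ i → linComb bs (T i) ≗ (λ j → K i ∧ ks i j))
  (j₀ : Fin b) (i₀ : Fin a) (Ki₀ : K i₀ ≡ true) (Ti₀j₀ : T i₀ j₀ ≡ true) where

  ks′ : Matrix a c
  ks′ i j = (K i ∧ ks i j) xor (T i j₀ ∧ ks i₀ j)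

  eliminated-inSpan : ∀ i → InSpan bs (B [ j₀ ]≔ false) (ks′ i)
  eliminated-inSpan i = T′ , ⊆-[]≔false T′⊆B T′j₀≡false , T′↦ks′
    where
    T′ : Bits b
    T′ j = T i j xor (T i j₀ ∧ T i₀ j)

    T′↦ks′ : linComb bs T′ ≗ ks′ i
    T′↦ks′ j = begin
      linComb bs T′ j
        ≡⟨ linComb-xor bs (T i) _ j ⟩
      linComb bs (T i) j xor linComb bs (λ j → T i j₀ ∧ T i₀ j) j
        ≡⟨ cong (linComb bs (T i) j xor_) (linComb-∧ˡ bs (T i j₀) (T i₀) j) ⟩
      linComb bs (T i) j xor (T i j₀ ∧ linComb bs (T i₀) j)
        ≡⟨ cong₂ (λ x y → x xor (T i j₀ ∧ y)) (T↦ks i j) (T↦ks i₀ j) ⟩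
      (K i ∧ ks i j) xor (T i j₀ ∧ (K i₀ ∧ ks i₀ j))
        ≡⟨ cong (λ z → (K i ∧ ks i j) xor (T i j₀ ∧ (z ∧ ks i₀ j))) Ki₀ ⟩
      ks′ i j ∎
      where open ≡-Reasoning

    T′j₀≡false : T′ j₀ ≡ false
    T′j₀≡false rewrite Ti₀j₀ | ∧-identityʳ (T i j₀) = xor-same (T i j₀)

    T′⊆B : T′ ⊆ B
    T′⊆B j T′j with T i j in Tij
    ... | true  = T⊆B i j Tij
    ... | false = T⊆B i₀ j (x∧y≡true⇒y≡true {T i j₀} T′j)

  linComb-eliminated : ∀ {S} → S ⊆ K → ∀ j →
                       linComb ks′ S j ≡ linComb ks S j xor (parity (λ i → S i ∧ T i j₀) ∧ ks i₀ j)
  linComb-eliminated {S} S⊆K j = begin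
    parity (λ i → S i ∧ ks′ i j)
      ≡⟨ parity-cong rowwise ⟩
    parity (λ i → (S i ∧ ks i j) xor ((S i ∧ T i j₀) ∧ ks i₀ j))
      ≡⟨ parity-xor (λ i → S i ∧ ks i j) _ ⟩
    linComb ks S j xor parity (λ i → (S i ∧ T i j₀) ∧ ks i₀ j)
      ≡⟨ cong (linComb ks S j xor_) (parity-∧ʳ (λ i → S i ∧ T i j₀) (ks i₀ j)) ⟩
    linComb ks S j xor (parity (λ i → S i ∧ T i j₀) ∧ ks i₀ j) ∎
    where
    open ≡-Reasoning
    rowwise : ∀ i → S i ∧ ks′ i j ≡ (S i ∧ ks i j) xor ((S i ∧ T i j₀) ∧ ks i₀ j)
    rowwise i with S i in Si
    ... | false = refl
    ... | true rewrite S⊆K i Si = refl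

  -- A dependency among the eliminated rows becomes one among the original rows
  -- once the pivot row is added back with the right coefficient.
  eliminated-independent : Independent ks K → Independent ks′ (K [ i₀ ]≔ false)
  eliminated-independent K-indep S S⊆K′ (w , Sw) S-kills = K-indep S″ S″⊆K (w , S″w) S″-kills
    where
    S⊆K : S ⊆ K
    S⊆K i = []≔false-⊆ K i₀ i ∘ S⊆K′ i

    Si₀≡false : S i₀ ≡ false
    Si₀≡false with S i₀ in Si₀
    ... | false = refl
    ... | true = ⊥-elim (≡true⇒≢false (S⊆K′ i₀ Si₀) ([]≔-updates K i₀ false))

    S″ : Bits a
    S″ = S [ i₀ ]≔ parity (λ i → S i ∧ T i j₀)

    S″⊆K : S″ ⊆ K
    S″⊆K i e with i ≟ i₀
    ... | yes refl = Ki₀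
    ... | no _ = S⊆K i e

    S″w : S″ w ≡ true
    S″w = trans ([]≔-minimal S i₀ _ (λ { refl → ≡true⇒≢false Sw Si₀≡false })) Sw

    S″-kills : Empty (linComb ks S″)
    S″-kills j = trans (linComb-[]≔ ks S i₀ _ Si₀≡false j)
                       (trans (sym (linComb-eliminated S⊆K j)) (S-kills j))

module Representation {a b c} (ks : Matrix a c) (K : Bits a) (bs : Matrix b c) (B : Bits b)
  (K⊆span : ∀ i → K i ≡ true → InSpan bs B (ks i)) where

  masked-inSpan : ∀ i → InSpan bs B (λ j → K i ∧ ks i j)
  masked-inSpan i with K i in Ki
  ... | true  = K⊆span i Ki
  ... | false = (λ _ → false) , (λ _ ()) , linComb-empty bs (λ _ → refl)

  T : Fin a → Bits b
  T i = proj₁ (masked-inSpan i)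

  T⊆B : ∀ i → T i ⊆ B
  T⊆B i = proj₁ (proj₂ (masked-inSpan i))

  T↦ks : ∀ i → linComb bs (T i) ≗ (λ j → K i ∧ ks i j)
  T↦ks i = proj₂ (proj₂ (masked-inSpan i))

-- Induction on |B|, for some j₀ ∈ B: if no representation of a row of K uses j₀, drop j₀
-- from B; otherwise eliminate j₀ from all representations using such a row as pivot, which
-- removes that row from K.
steinitz : ∀ {a b c} (ks : Matrix a c) (K : Bits a) (bs : Matrix b c) (B : Bits b) →
           Independent ks K → (∀ i → K i ≡ true → InSpan bs B (ks i)) → card K ≤ card B
steinitz {a} {b} {c} ks K bs B = bounded-by (card B) ks K B refl
  where
  bounded-by : ∀ m (ks : Matrix a c) K (B : Bits b) → card B ≡ m → Independent ks K →
               (∀ i → K i ≡ true → InSpan bs B (ks i)) → card K ≤ m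
  bounded-by zero ks K B |B|≡0 K-indep K⊆span = ≤-reflexive (card-empty K-empty)
    where
    K-empty : Empty K
    K-empty i with K i in Ki
    ... | false = refl
    ... | true = ⊥-elim (independent⇒row-nonzero ks K-indep Ki
                          (inSpan-empty bs (card≡0⇒empty B |B|≡0) (K⊆span i Ki)))
  bounded-by (suc m) ks K B |B|≡1+m K-indep K⊆span =
    drop-or-eliminate (inhabited-or-empty (λ i → K i ∧ T i j₀))
    where
    open Representation ks K bs B K⊆span
    j₀ : Fin b
    j₀ = proj₁ (card≡suc⇒inhabited B |B|≡1+m)

    B′ : Bits b
    B′ = B [ j₀ ]≔ false

    |B′|≡m : card B′ ≡ m
    |B′|≡m = cong pred (trans (sym (card-remove B j₀ (proj₂ (card≡suc⇒inhabited B |B|≡1+m)))) |B|≡1+m)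

    drop-or-eliminate : Inhabited (λ i → K i ∧ T i j₀) ⊎ Empty (λ i → K i ∧ T i j₀) → card K ≤ suc m
    drop-or-eliminate (inj₂ j₀-unused) = ≤-trans (bounded-by m ks K B′ |B′|≡m K-indep K⊆span′) (n≤1+n m)
      where
      K⊆span′ : ∀ i → K i ≡ true → InSpan bs B′ (ks i)
      K⊆span′ i Ki = T i , ⊆-[]≔false (T⊆B i) (subst (λ z → z ∧ T i j₀ ≡ false) Ki (j₀-unused i)) ,
                     λ j → trans (T↦ks i j) (cong (_∧ ks i j) Ki)
    drop-or-eliminate (inj₁ (i₀ , Ki₀∧Ti₀j₀)) =
      subst (_≤ suc m) (sym (card-remove K i₀ Ki₀))
        (s≤s (bounded-by m ks′ (K [ i₀ ]≔ false) B′ |B′|≡m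
                (eliminated-independent K-indep) (λ i _ → eliminated-inSpan i)))
      where
      Ki₀ : K i₀ ≡ true
      Ki₀ = x∧y≡true⇒x≡true Ki₀∧Ti₀j₀
      open Elimination ks K bs B T T⊆B T↦ks j₀ i₀ Ki₀ (x∧y≡true⇒y≡true {K i₀} Ki₀∧Ti₀j₀)

anyᵇ-sound : ∀ {n} (f : Fin n → Bool) → anyᵇ f ≡ true → Inhabited f
anyᵇ-sound {suc n} f e with f zero in f0
... | true = zero , f0
... | false with anyᵇ-sound (f ∘ suc) e
...   | j , fj = suc j , fj

anyᵇ-complete : ∀ {n} (f : Fin n → Bool) → Inhabited f → anyᵇ f ≡ true
anyᵇ-complete f (zero , f0) rewrite f0 = refl
anyᵇ-complete f (suc j , fj) with f zero
... | true  = refl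
... | false = anyᵇ-complete (f ∘ suc) (j , fj)

anyᵇ≡false⇒empty : ∀ {n} (f : Fin n → Bool) → anyᵇ f ≡ false → Empty f
anyᵇ≡false⇒empty f e j with f j in fj
... | false = refl
... | true = ⊥-elim (≡true⇒≢false (anyᵇ-complete f (j , fj)) e)

empty⇒anyᵇ≡false : ∀ {n} (f : Fin n → Bool) → Empty f → anyᵇ f ≡ false
empty⇒anyᵇ≡false f f-empty with anyᵇ f in e
... | false = refl
... | true with anyᵇ-sound f e
...   | j , fj = ⊥-elim (≡true⇒≢false fj (f-empty j))

subsetᵇ-complete : ∀ {n} (T S : Vec Bool n) → lookup T ⊆ lookup S → subsetᵇ T S ≡ true
subsetᵇ-complete T S T⊆S = cong not (empty⇒anyᵇ≡false _ violation-free)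
  where
  violation-free : ∀ i → not (not (lookup T i) ∨ lookup S i) ≡ false
  violation-free i with lookup T i in Ti
  ... | false = refl
  ... | true rewrite T⊆S i Ti = refl

subsetᵇ-sound : ∀ {n} (T S : Vec Bool n) → subsetᵇ T S ≡ true → lookup T ⊆ lookup S
subsetᵇ-sound T S e i Ti with anyᵇ (λ i → not (not (lookup T i) ∨ lookup S i)) in violations
subsetᵇ-sound T S e i Ti | false with anyᵇ≡false⇒empty _ violations i
... | _ rewrite Ti with lookup S i
...   | true = refl

allL-sound : ∀ {A : Set} (p : A → Bool) xs → allL p xs ≡ true → ∀ {x} → x ∈ xs → p x ≡ true
allL-sound p (y ∷ xs) e (here refl) with p y
... | true = refl
allL-sound p (y ∷ xs) e (there x∈xs) with p y
... | true = allL-sound p xs e x∈xs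

allL≡false⇒counterexample : ∀ {A : Set} (p : A → Bool) xs → allL p xs ≡ false →
                            ∃[ x ] (x ∈ xs × p x ≡ false)
allL≡false⇒counterexample p (y ∷ xs) e with p y in py
... | false = y , here refl , py
... | true with allL≡false⇒counterexample p xs e
...   | x , x∈xs , px = x , there x∈xs , px

filterL-∈⁺ : ∀ {A : Set} (p : A → Bool) {xs x} → x ∈ xs → p x ≡ true → x ∈ filterL p xs
filterL-∈⁺ p {y ∷ xs} (here refl) px rewrite px = here refl
filterL-∈⁺ p {y ∷ xs} (there x∈xs) px with p y
... | true  = there (filterL-∈⁺ p x∈xs px)
... | false = filterL-∈⁺ p x∈xs px

filterL-∈⁻ : ∀ {A : Set} (p : A → Bool) xs {x} → x ∈ filterL p xs → p x ≡ true
filterL-∈⁻ p (y ∷ xs) x∈ with p y in py | x∈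
... | true  | here refl = py
... | true  | there x∈′ = filterL-∈⁻ p xs x∈′
... | false | x∈′ = filterL-∈⁻ p xs x∈′

maxList-upper : ∀ {x} xs → x ∈ xs → x ≤ maxList xs
maxList-upper (y ∷ xs) (here refl) = m≤m⊔n y (maxList xs)
maxList-upper (y ∷ xs) (there x∈xs) = ≤-trans (maxList-upper xs x∈xs) (m≤n⊔m y (maxList xs))

maxList-attained : ∀ xs → maxList xs ≡ 0 ⊎ maxList xs ∈ xs
maxList-attained [] = inj₁ refl
maxList-attained (y ∷ xs) with ⊔-sel y (maxList xs)
... | inj₁ e = inj₂ (subst (_∈ y ∷ xs) (sym e) (here refl))
... | inj₂ e with maxList-attained xs
...   | inj₁ z = inj₁ (trans e z)
...   | inj₂ m = inj₂ (subst (_∈ y ∷ xs) (sym e) (there m))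

allSubsets-complete : ∀ {n} (S : Subset n) → S ∈ allSubsets n
allSubsets-complete [] = here refl
allSubsets-complete {suc n} (true ∷ S) = ∈-++⁺ˡ (∈-map⁺ (true ∷_) (allSubsets-complete S))
allSubsets-complete {suc n} (false ∷ S) =
  ∈-++⁺ʳ (map (true ∷_) (allSubsets n)) (∈-map⁺ (false ∷_) (allSubsets-complete S))

∣tabulate∣≡card : ∀ {n} (S : Bits n) → ∣ tabulate S ∣ ≡ card S
∣tabulate∣≡card {zero} S = refl
∣tabulate∣≡card {suc n} S with S zero
... | true  = cong suc (∣tabulate∣≡card (S ∘ suc))
... | false = ∣tabulate∣≡card (S ∘ suc)

module _ {r c : ℕ} (M : Matrix r c) where

  combination≗linComb : ∀ T → combination M (tabulate T) ≗ linComb M T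
  combination≗linComb T j = parity-cong (λ i → cong (_∧ M i j) (lookup∘tabulate T i))

  independentᵇ-sound : ∀ S → independentᵇ M (tabulate S) ≡ true → Independent M S
  independentᵇ-sound S e T T⊆S T-inhabited T-kills =
    ≡true⇒≢false (trans (sym (combination≗linComb T j)) Mj) (T-kills j)
    where
    verdict : (not (subsetᵇ (tabulate T) (tabulate S) ∧ nonemptyᵇ (tabulate T)) ∨
               anyᵇ (combination M (tabulate T))) ≡ true
    verdict = allL-sound _ (allSubsets r) e (allSubsets-complete (tabulate T))

    T⊆ᵇS : subsetᵇ (tabulate T) (tabulate S) ≡ true
    T⊆ᵇS = subsetᵇ-complete (tabulate T) (tabulate S) λ i Ti →
             trans (lookup∘tabulate S i) (T⊆S i (trans (sym (lookup∘tabulate T i)) Ti))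

    T≢ᵇ∅ : nonemptyᵇ (tabulate T) ≡ true
    T≢ᵇ∅ = anyᵇ-complete (lookup (tabulate T))
             (proj₁ T-inhabited , trans (lookup∘tabulate T _) (proj₂ T-inhabited))

    combination-nonzero : Inhabited (combination M (tabulate T))
    combination-nonzero = anyᵇ-sound _
      (subst₂ (λ x y → (not (x ∧ y) ∨ anyᵇ (combination M (tabulate T))) ≡ true) T⊆ᵇS T≢ᵇ∅ verdict)

    j : Fin c
    j = proj₁ combination-nonzero

    Mj : combination M (tabulate T) j ≡ true
    Mj = proj₂ combination-nonzero

  independentᵇ≡false⇒dependent : ∀ S → independentᵇ M (tabulate S) ≡ false → Dependent M S
  independentᵇ≡false⇒dependent S e = from-counterexample (allL≡false⇒counterexample _ (allSubsets r) e)
    where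
    from-counterexample : ∃[ T ] (T ∈ allSubsets r ×
                            (not (subsetᵇ T (tabulate S) ∧ nonemptyᵇ T) ∨ anyᵇ (combination M T)) ≡ false) →
                          Dependent M S
    from-counterexample (T , _ , verdict)
      with subsetᵇ T (tabulate S) in T⊆ᵇS | nonemptyᵇ T in T≢ᵇ∅ | anyᵇ (combination M T) in T-kills
    ... | true | true | false =
      lookup T ,
      (λ i Ti → trans (sym (lookup∘tabulate S i)) (subsetᵇ-sound T (tabulate S) T⊆ᵇS i Ti)) ,
      anyᵇ-sound (lookup T) T≢ᵇ∅ ,
      λ j → trans (sym (combination≗linComb (lookup T) j))
                  (trans (cong (λ T′ → combination M T′ j) (tabulate∘lookup T))
                         (anyᵇ≡false⇒empty _ T-kills j))

  independentᵇ-complete : ∀ S → Independent M S → independentᵇ M (tabulate S) ≡ true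
  independentᵇ-complete S S-indep with independentᵇ M (tabulate S) in e
  ... | true  = refl
  ... | false with independentᵇ≡false⇒dependent S e
  ...   | T , T⊆S , T-inhabited , T-kills = ⊥-elim (S-indep T T⊆S T-inhabited T-kills)

  independent-or-dependent : ∀ S → Independent M S ⊎ Dependent M S
  independent-or-dependent S with independentᵇ M (tabulate S) in e
  ... | true  = inj₁ (independentᵇ-sound S e)
  ... | false = inj₂ (independentᵇ≡false⇒dependent S e)

  rankGF2-isRank : IsRank M (λ _ → true) (rankGF2 M)
  rankGF2-isRank = record
    { upper             = λ K _ K-indep → subst (_≤ rankGF2 M) (∣tabulate∣≡card K)
                            (maxList-upper _ (∈-map⁺ ∣_∣
                              (filterL-∈⁺ (independentᵇ M) (allSubsets-complete (tabulate K))
                                          (independentᵇ-complete K K-indep))))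
    ; basis             = proj₁ maximum
    ; basis⊆            = λ _ _ → refl
    ; basis-independent = proj₁ (proj₂ maximum)
    ; card-basis        = proj₂ (proj₂ maximum)
    }
    where
    maximum : ∃[ I ] (Independent M I × card I ≡ rankGF2 M)
    maximum with maxList-attained (map ∣_∣ (filterL (independentᵇ M) (allSubsets r)))
    ... | inj₁ rank≡0 = (λ _ → false) , (λ { T T⊆∅ (w , Tw) _ → ≡true⇒≢false (T⊆∅ w Tw) refl }) ,
                        trans (card-empty {r} {λ _ → false} (λ _ → refl)) (sym rank≡0)
    ... | inj₂ rank∈ with ∈-map⁻ ∣_∣ rank∈
    ...   | I , I∈ , rank≡∣I∣ =
      lookup I ,
      independentᵇ-sound (lookup I) (subst (λ I′ → independentᵇ M I′ ≡ true) (sym (tabulate∘lookup I))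
                                           (filterL-∈⁻ (independentᵇ M) (allSubsets r) I∈)) ,
      trans (sym (∣tabulate∣≡card (lookup I))) (trans (cong ∣_∣ (tabulate∘lookup I)) (sym rank≡∣I∣))

-- Bases and submodularity of the rank

xor≡false⇒≡ : ∀ {x y} → x xor y ≡ false → x ≡ y
xor≡false⇒≡ {true}  {true}  _ = refl
xor≡false⇒≡ {false} {false} _ = refl

module _ {N c : ℕ} (v : Matrix N c) where

  -- Since J is independent, the dependency uses x, and solving it for v x expresses v x over J.
  dependent-insert⇒inSpan : ∀ {J} x → Independent v J → Dependent v (J [ x ]≔ true) → InSpan v J (v x)
  dependent-insert⇒inSpan {J} x J-indep (T , T⊆J+x , T-inhabited , T-kills) with J x in Jx
  ... | true = inSpan-row v x Jx
  ... | false = T′ , T′⊆J , T′↦vx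
    where
    T′ : Bits N
    T′ = T [ x ]≔ false

    T′⊆J : T′ ⊆ J
    T′⊆J = ⊆[]≔true⇒⊆ (λ i → T⊆J+x i ∘ []≔false-⊆ T x i) ([]≔-updates T x false)

    Tx≡true : T x ≡ true
    Tx≡true with T x in Tx
    ... | true  = refl
    ... | false = ⊥-elim (J-indep T (⊆[]≔true⇒⊆ T⊆J+x Tx) T-inhabited T-kills)

    T′+x≗T : (T′ [ x ]≔ true) ≗ T
    T′+x≗T i with i ≟ x
    ... | yes refl = sym Tx≡true
    ... | no _ = refl

    T′↦vx : linComb v T′ ≗ v x
    T′↦vx j = xor≡false⇒≡ (begin
      linComb v T′ j xor (true ∧ v x j) ≡⟨ linComb-[]≔ v T′ x true ([]≔-updates T x false) j ⟨
      linComb v (T′ [ x ]≔ true) j      ≡⟨ linComb-cong v T′+x≗T j ⟩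
      linComb v T j                     ≡⟨ T-kills j ⟩
      false                             ∎)
      where open ≡-Reasoning

  module _ {ρ} (R : IsRank v (λ _ → true) ρ) where
    open IsRank R

    basis-spans : ∀ x → InSpan v basis (v x)
    basis-spans x with independent-or-dependent v (basis [ x ]≔ true)
    ... | inj₂ basis+x-dep = dependent-insert⇒inSpan x basis-independent basis+x-dep
    ... | inj₁ basis+x-indep with basis x in basis-x
    ...   | true  = inSpan-row v x basis-x
    ...   | false = ⊥-elim (<-irrefl refl (begin
      suc (card basis)          ≡⟨ card-insert basis x basis-x ⟨
      card (basis [ x ]≔ true)  ≤⟨ upper _ (λ _ _ → refl) basis+x-indep ⟩
      ρ                         ≡⟨ card-basis ⟨
      card basis                ∎))
      where open ≤-Reasoning

  record SpanningExtension (U J : Bits N) (xs : List (Fin N)) : Set where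
    field
      J′          : Bits N
      J⊆J′        : J ⊆ J′
      J′⊆U        : J′ ⊆ U
      independent : Independent v J′
      spans       : ∀ u → u ∈ xs → U u ≡ true → InSpan v J′ (v u)

  extension-∷ : ∀ {U J J₀ xs} x (E : SpanningExtension U J₀ xs) → J ⊆ J₀ →
                (U x ≡ true → InSpan v (SpanningExtension.J′ E) (v x)) → SpanningExtension U J (x ∷ xs)
  extension-∷ x E J⊆J₀ spans-x = record
    { J′ = J′ ; J⊆J′ = λ i → J⊆J′ i ∘ J⊆J₀ i ; J′⊆U = J′⊆U ; independent = independent
    ; spans = λ { u (here refl) → spans-x ; u (there u∈xs) → spans u u∈xs } }
    where open SpanningExtension E

  extend-to-spanning : ∀ U xs J → J ⊆ U → Independent v J → SpanningExtension U J xs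
  extend-to-spanning U [] J J⊆U J-indep = record
    { J′ = J ; J⊆J′ = λ _ Ji → Ji ; J′⊆U = J⊆U ; independent = J-indep ; spans = λ _ () }
  extend-to-spanning U (x ∷ xs) J J⊆U J-indep with U x in Ux
  ... | false = extension-∷ x (extend-to-spanning U xs J J⊆U J-indep) (λ _ Ji → Ji)
                  (λ Ux′ → ⊥-elim (≡true⇒≢false Ux′ Ux))
  ... | true with independent-or-dependent v (J [ x ]≔ true)
  ...   | inj₂ J+x-dep = extension-∷ x E (λ _ Ji → Ji)
                           (λ _ → inSpan-mono v (SpanningExtension.J⊆J′ E)
                                                   (dependent-insert⇒inSpan x J-indep J+x-dep))
    where E = extend-to-spanning U xs J J⊆U J-indep
  ...   | inj₁ J+x-indep = extension-∷ x E (⊆-[]≔true J x)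
                             (λ _ → inSpan-row v x (SpanningExtension.J⊆J′ E x ([]≔-updates J x true)))
    where E = extend-to-spanning U xs (J [ x ]≔ true) ([]≔true-⊆ J⊆U Ux) J+x-indep

rank≤card-spanning : ∀ {r c} (v : Matrix r c) {U J ρ} → IsRank v U ρ →
                     (∀ u → U u ≡ true → InSpan v J (v u)) → ρ ≤ card J
rank≤card-spanning v {J = J} R J-spans =
  subst (_≤ card J) card-basis (steinitz v basis v J basis-independent (λ k Bk → J-spans k (basis⊆ k Bk)))
  where open IsRank R

-- Extend a basis I of S ∩ T to a basis J of S ∪ T; then J ∩ S and J ∩ T are independent
-- subsets of S and T whose sizes add up to |J| + |J ∩ S ∩ T| ≥ |I| + |J|.
submodular : ∀ {N c} (v : Matrix N c) {S T ρS ρT ρ∩ ρ∪} →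
             IsRank v S ρS → IsRank v T ρT → IsRank v (S ∩ᵇ T) ρ∩ → IsRank v (S ∪ᵇ T) ρ∪ →
             ρ∩ + ρ∪ ≤ ρS + ρT
submodular {N} v {S} {T} {ρS} {ρT} {ρ∩} {ρ∪} S-rank T-rank ∩-rank ∪-rank = begin
  ρ∩ + ρ∪                                 ≤⟨ +-mono-≤ ρ∩≤ ρ∪≤ ⟩
  card (JS ∩ᵇ JT) + card (JS ∪ᵇ JT)       ≡⟨ +-comm (card (JS ∩ᵇ JT)) _ ⟩
  card (JS ∪ᵇ JT) + card (JS ∩ᵇ JT)       ≡⟨ card-∪-∩ JS JT ⟩
  card JS + card JT                       ≤⟨ +-mono-≤ JS≤ρS JT≤ρT ⟩
  ρS + ρT                                 ∎
  where
  open ≤-Reasoning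
  open IsRank ∩-rank using (basis⊆; basis-independent; card-basis) renaming (basis to I)

  open SpanningExtension
    (extend-to-spanning v (S ∪ᵇ T) (allFin N) I (λ i → ∩ᵇ⊆∪ᵇ {S = S} {T} i ∘ basis⊆ i) basis-independent)

  JS JT : Bits N
  JS = J′ ∩ᵇ S
  JT = J′ ∩ᵇ T

  ρ∩≤ : ρ∩ ≤ card (JS ∩ᵇ JT)
  ρ∩≤ = subst (_≤ card (JS ∩ᵇ JT)) card-basis (card-mono I⊆JS∩JT)
    where
    I⊆JS∩JT : I ⊆ (JS ∩ᵇ JT)
    I⊆JS∩JT i Ii with J⊆J′ i Ii | S i | T i | basis⊆ i Ii
    ... | J′i | true | true | _ rewrite J′i = refl

  ρ∪≤ : ρ∪ ≤ card (JS ∪ᵇ JT)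
  ρ∪≤ = subst (ρ∪ ≤_) (card-cong (⊆∪ᵇ⇒≗∩ᵇ∪ᵇ∩ᵇ J′⊆U))
          (rank≤card-spanning v ∪-rank (λ u Uu → spans u (∈-allFin u) Uu))

  J′∩-bounded : ∀ {X ρ} → IsRank v X ρ → card (J′ ∩ᵇ X) ≤ ρ
  J′∩-bounded R = IsRank.upper R _ (λ i → x∧y≡true⇒y≡true {J′ i})
                    (independent-antimono v independent (λ i → x∧y≡true⇒x≡true))

  JS≤ρS : card JS ≤ ρS
  JS≤ρS = J′∩-bounded S-rank

  JT≤ρT : card JT ≤ ρT
  JT≤ρT = J′∩-bounded T-rank

-- Submodularity of the cut-rank

card-++ᶠ : ∀ {m n} (A : Bits m) (B : Bits n) → card (A ++ᶠ B) ≡ card A + card B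
card-++ᶠ {m} {n} A B =
  trans (card-split m n (A ++ᶠ B)) (cong₂ _+_ (card-cong (lookup-++ˡ A B)) (card-cong (lookup-++ʳ A B)))

++ᶠ-mono : ∀ {m n} {A A′ : Bits m} {B B′ : Bits n} → A ⊆ A′ → B ⊆ B′ → (A ++ᶠ B) ⊆ (A′ ++ᶠ B′)
++ᶠ-mono {m} A⊆A′ B⊆B′ k with splitAt m k
... | inj₁ i = A⊆A′ i
... | inj₂ j = B⊆B′ j

splitAt-view : ∀ m {n} (k : Fin (m + n)) → (∃[ i ] k ≡ i ↑ˡ n) ⊎ (∃[ j ] k ≡ m ↑ʳ j)
splitAt-view m k with splitAt m k in e
... | inj₁ i = inj₁ (i , sym (splitAt⁻¹-↑ˡ e))
... | inj₂ j = inj₂ (j , sym (splitAt⁻¹-↑ʳ e))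

+-cancel-≤-interchanged : ∀ a b c d p q r s → (a + p) + (b + q) ≤ (c + r) + (d + s) → p + q ≡ r + s →
                          a + b ≤ c + d
+-cancel-≤-interchanged a b c d p q r s le sums = +-cancelʳ-≤ (p + q) (a + b) (c + d) (begin
  (a + b) + (p + q)   ≡⟨ +-interchange a b p q ⟩
  (a + p) + (b + q)   ≤⟨ le ⟩
  (c + r) + (d + s)   ≡⟨ +-interchange c r d s ⟩
  (c + d) + (r + s)   ≡⟨ cong ((c + d) +_) sums ⟨
  (c + d) + (p + q)   ∎)
  where open ≤-Reasoning

module CutRank {n : ℕ} (G : Graph n) where

  -- cutrk G A is by definition rankGF2 (cutMatrix (lookup A))
  cutMatrix : Bits n → Matrix n n
  cutMatrix X i j = X i ∧ (adj G i j ∧ not (X j))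

  stacked : Matrix (n + n) n
  stacked = adj G ++ᶠ singleton

  top bottom : Bits (n + n) → Bits n
  top T i = T (i ↑ˡ n)
  bottom T j = T (n ↑ʳ j)

  linComb-stacked : ∀ T j → linComb stacked T j ≡ linComb (adj G) (top T) j xor bottom T j
  linComb-stacked T j = trans (parity-split n n (λ k → T k ∧ stacked k j))
    (cong₂ _xor_ (parity-cong (λ i → cong (λ row → top T i ∧ row j) (lookup-++ˡ (adj G) singleton i)))
                 (trans (parity-cong (λ i → cong (λ row → bottom T i ∧ row j) (lookup-++ʳ (adj G) singleton i)))
                        (linComb-identity (bottom T) j)))

  linComb-cutMatrix : ∀ {X A} → A ⊆ X → ∀ j → linComb (cutMatrix X) A j ≡ linComb (adj G) A j ∧ not (X j)
  linComb-cutMatrix {X} {A} A⊆X j =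
    trans (parity-cong rowwise) (parity-∧ʳ (λ i → A i ∧ adj G i j) (not (X j)))
    where
    rowwise : ∀ i → A i ∧ (X i ∧ (adj G i j ∧ not (X j))) ≡ (A i ∧ adj G i j) ∧ not (X j)
    rowwise i with A i in Ai
    ... | false = refl
    ... | true rewrite A⊆X i Ai = refl

  independent-cutMatrix⇒⊆ : ∀ {X I} → Independent (cutMatrix X) I → I ⊆ X
  independent-cutMatrix⇒⊆ {X} I-indep i Ii with X i in Xi
  ... | true = refl
  ... | false = ⊥-elim (independent⇒row-nonzero (cutMatrix X) I-indep Ii
                          (λ j → cong (_∧ (adj G i j ∧ not (X j))) Xi))

  -- At columns in X the rows of cutMatrix X vanish; at columns outside X the unit rows
  -- indexed by X contribute nothing. So a dependency of stacked inside I ++ᶠ X has its top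
  -- half as a dependency of cutMatrix X inside I, unless that top half is empty.
  stacked-independent : ∀ {X I} → Independent (cutMatrix X) I → Independent stacked (I ++ᶠ X)
  stacked-independent {X} {I} I-indep T T⊆I++X (w , Tw) T-kills with inhabited-or-empty (top T)
  ... | inj₁ top-inhabited = I-indep (top T) top⊆I top-inhabited top-kills
    where
    top⊆I : top T ⊆ I
    top⊆I i e = trans (sym (lookup-++ˡ I X i)) (T⊆I++X _ e)

    bottom⊆X : bottom T ⊆ X
    bottom⊆X j e = trans (sym (lookup-++ʳ I X j)) (T⊆I++X _ e)

    top-kills′ : ∀ j → linComb (adj G) (top T) j ∧ not (X j) ≡ false
    top-kills′ j with X j in Xj
    ... | true = ∧-zeroʳ _
    ... | false with bottom T j in Bj
    ...   | true = ⊥-elim (≡true⇒≢false (bottom⊆X j Bj) Xj)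
    ...   | false = begin
      linComb (adj G) (top T) j ∧ true              ≡⟨ ∧-identityʳ _ ⟩
      linComb (adj G) (top T) j                     ≡⟨ xor-identityʳ _ ⟨
      linComb (adj G) (top T) j xor false           ≡⟨ cong (linComb (adj G) (top T) j xor_) Bj ⟨
      linComb (adj G) (top T) j xor bottom T j      ≡⟨ linComb-stacked T j ⟨
      linComb stacked T j                           ≡⟨ T-kills j ⟩
      false                                         ∎
      where open ≡-Reasoning

    top-kills : Empty (linComb (cutMatrix X) (top T))
    top-kills j = trans (linComb-cutMatrix {X} (λ i → independent-cutMatrix⇒⊆ {X} I-indep i ∘ top⊆I i) j)
                        (top-kills′ j)
  ... | inj₂ top-empty with splitAt-view n w
  ...   | inj₁ (i , refl) = ≡true⇒≢false Tw (top-empty i)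
  ...   | inj₂ (j , refl) = ≡true⇒≢false Tw (begin
      T (n ↑ʳ j)                                 ≡⟨⟩
      false xor T (n ↑ʳ j)
        ≡⟨ cong (_xor T (n ↑ʳ j)) (linComb-empty (adj G) top-empty j) ⟨
      linComb (adj G) (top T) j xor T (n ↑ʳ j)   ≡⟨ linComb-stacked T j ⟨
      linComb stacked T j                        ≡⟨ T-kills j ⟩
      false                                      ∎)
      where open ≡-Reasoning

  -- Outside X, row i ∈ X of the adjacency matrix agrees with row i of cutMatrix X;
  -- the unit rows of X correct the columns inside X.
  adjacency-row-inSpan : ∀ {X A i} → X i ≡ true → A ⊆ X → linComb (cutMatrix X) A ≗ cutMatrix X i →
                         InSpan stacked (A ++ᶠ X) (stacked (i ↑ˡ n))
  adjacency-row-inSpan {X} {A} {i} Xi A⊆X A↦cut = A ++ᶠ D , ++ᶠ-mono (λ _ Ai → Ai) D⊆X , A++D↦row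
    where
    D : Bits n
    D j = X j ∧ (linComb (adj G) A j xor adj G i j)

    D⊆X : D ⊆ X
    D⊆X j = x∧y≡true⇒x≡true

    corrected : ∀ j → linComb (adj G) A j xor D j ≡ adj G i j
    corrected j with X j in Xj
    ... | true = trans (sym (xor-assoc (linComb (adj G) A j) _ (adj G i j)))
                       (cong (_xor adj G i j) (xor-same (linComb (adj G) A j)))
    ... | false = begin
      linComb (adj G) A j xor false        ≡⟨ xor-identityʳ _ ⟩
      linComb (adj G) A j                  ≡⟨ ∧-identityʳ _ ⟨
      linComb (adj G) A j ∧ not false      ≡⟨ cong (λ b → linComb (adj G) A j ∧ not b) Xj ⟨
      linComb (adj G) A j ∧ not (X j)      ≡⟨ linComb-cutMatrix {X} A⊆X j ⟨
      linComb (cutMatrix X) A j            ≡⟨ A↦cut j ⟩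
      X i ∧ (adj G i j ∧ not (X j))        ≡⟨ cong₂ (λ a b → a ∧ (adj G i j ∧ not b)) Xi Xj ⟩
      adj G i j ∧ true                     ≡⟨ ∧-identityʳ _ ⟩
      adj G i j                            ∎
      where open ≡-Reasoning

    A++D↦row : linComb stacked (A ++ᶠ D) ≗ stacked (i ↑ˡ n)
    A++D↦row j = begin
      linComb stacked (A ++ᶠ D) j
        ≡⟨ linComb-stacked (A ++ᶠ D) j ⟩
      linComb (adj G) (top (A ++ᶠ D)) j xor bottom (A ++ᶠ D) j
        ≡⟨ cong₂ _xor_ (linComb-cong (adj G) (lookup-++ˡ A D) j) (lookup-++ʳ A D j) ⟩
      linComb (adj G) A j xor D j
        ≡⟨ corrected j ⟩
      adj G i j
        ≡⟨ cong (λ row → row j) (lookup-++ˡ (adj G) singleton i) ⟨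
      stacked (i ↑ˡ n) j ∎
      where open ≡-Reasoning


  stacked-spanned : ∀ {X ρ} (R : IsRank (cutMatrix X) (λ _ → true) ρ) →
                    ∀ k → (X ++ᶠ X) k ≡ true → InSpan stacked (IsRank.basis R ++ᶠ X) (stacked k)
  stacked-spanned {X} R k Xk with splitAt-view n k
  ... | inj₂ (j , refl) =
    inSpan-row stacked (n ↑ʳ j) (trans (lookup-++ʳ (IsRank.basis R) X j) (trans (sym (lookup-++ʳ X X j)) Xk))
  ... | inj₁ (i , refl) with basis-spans (cutMatrix X) R i
  ...   | A , A⊆I , A↦cut =
    inSpan-mono stacked (++ᶠ-mono A⊆I (λ _ Xj → Xj))
      (adjacency-row-inSpan (trans (sym (lookup-++ˡ X X i)) Xk)
                            (λ x → independent-cutMatrix⇒⊆ {X} (IsRank.basis-independent R) x ∘ A⊆I x) A↦cut)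

  cutMatrix-isRank : ∀ X → IsRank stacked (X ++ᶠ X) (rankGF2 (cutMatrix X) + card X)
  cutMatrix-isRank X = record
    { upper             = λ K K⊆X++X K-indep → subst (card K ≤_) |I++X|≡rank+|X|
                            (steinitz stacked K stacked (I ++ᶠ X) K-indep
                              (λ k Kk → stacked-spanned cut-rank k (K⊆X++X k Kk)))
    ; basis             = I ++ᶠ X
    ; basis⊆            = ++ᶠ-mono (independent-cutMatrix⇒⊆ {X} basis-independent) (λ _ Xj → Xj)
    ; basis-independent = stacked-independent basis-independent
    ; card-basis        = |I++X|≡rank+|X|
    }
    where
    cut-rank : IsRank (cutMatrix X) (λ _ → true) (rankGF2 (cutMatrix X))
    cut-rank = rankGF2-isRank (cutMatrix X)
    open IsRank cut-rank using (basis-independent; card-basis) renaming (basis to I)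

    |I++X|≡rank+|X| : card (I ++ᶠ X) ≡ rankGF2 (cutMatrix X) + card X
    |I++X|≡rank+|X| = trans (card-++ᶠ I X) (cong (_+ card X) card-basis)

  cutrk-submodular : ∀ (X Y : Subset n) → cutrk G (X ∩ Y) + cutrk G (X ∪ Y) ≤ cutrk G X + cutrk G Y
  cutrk-submodular X Y =
    +-cancel-≤-interchanged (cutrk G (X ∩ Y)) (cutrk G (X ∪ Y)) (cutrk G X) (cutrk G Y) _ _ _ _
      (submodular stacked (rank X) (rank Y)
                  (IsRank-cong halves-∩ (rank (X ∩ Y))) (IsRank-cong halves-∪ (rank (X ∪ Y))))
      sizes
    where
    rank : ∀ Z → IsRank stacked (lookup Z ++ᶠ lookup Z) (cutrk G Z + card (lookup Z))
    rank Z = cutMatrix-isRank (lookup Z)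

    ∩-pointwise : lookup (X ∩ Y) ≗ (lookup X ∩ᵇ lookup Y)
    ∩-pointwise i = lookup-zipWith _∧_ i X Y

    ∪-pointwise : lookup (X ∪ Y) ≗ (lookup X ∪ᵇ lookup Y)
    ∪-pointwise i = lookup-zipWith _∨_ i X Y

    halves-∩ : (lookup (X ∩ Y) ++ᶠ lookup (X ∩ Y)) ≗ ((lookup X ++ᶠ lookup X) ∩ᵇ (lookup Y ++ᶠ lookup Y))
    halves-∩ k with splitAt n k
    ... | inj₁ i = ∩-pointwise i
    ... | inj₂ i = ∩-pointwise i

    halves-∪ : (lookup (X ∪ Y) ++ᶠ lookup (X ∪ Y)) ≗ ((lookup X ++ᶠ lookup X) ∪ᵇ (lookup Y ++ᶠ lookup Y))
    halves-∪ k with splitAt n k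
    ... | inj₁ i = ∪-pointwise i
    ... | inj₂ i = ∪-pointwise i

    sizes : card (lookup (X ∩ Y)) + card (lookup (X ∪ Y)) ≡ card (lookup X) + card (lookup Y)
    sizes = trans (+-comm (card (lookup (X ∩ Y))) _)
                  (trans (cong₂ _+_ (card-cong ∪-pointwise) (card-cong ∩-pointwise))
                         (card-∪-∩ (lookup X) (lookup Y)))

-- Trees

Unique-++⁻ˡ : ∀ {A : Set} (xs : List A) {ys} → Unique (xs ++ ys) → Unique xs
Unique-++⁻ˡ []       _             = []
Unique-++⁻ˡ (x ∷ xs) (x∉ ∷ unique) = ++⁻ˡ xs x∉ ∷ Unique-++⁻ˡ xs unique

Unique-++⁻ʳ : ∀ {A : Set} (xs : List A) {ys} → Unique (xs ++ ys) → Unique ys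
Unique-++⁻ʳ []       unique       = unique
Unique-++⁻ʳ (x ∷ xs) (_ ∷ unique) = Unique-++⁻ʳ xs unique

Unique-++⇒disjoint : ∀ {A : Set} (xs : List A) {ys x} → Unique (xs ++ ys) → x ∈ xs → x ∈ ys → ⊥
Unique-++⇒disjoint (y ∷ xs) (y∉ ∷ _)      (here refl) x∈ys = All.lookup (++⁻ʳ xs y∉) x∈ys refl
Unique-++⇒disjoint (y ∷ xs) (_ ∷ unique) (there x∈xs) x∈ys = Unique-++⇒disjoint xs unique x∈xs x∈ys

leavesAt : ∀ {A : Set} → BTree A → Path → List A
leavesAt T p = maybe leaves [] (subAt T p)

leavesAt-⊆ : ∀ {A : Set} (T : BTree A) p {x} → x ∈ leavesAt T p → x ∈ leaves T
leavesAt-⊆ T          []          x∈ = x∈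
leavesAt-⊆ (node l r) (false ∷ p) x∈ = ∈-++⁺ˡ (leavesAt-⊆ l p x∈)
leavesAt-⊆ (node l r) (true ∷ p)  x∈ = ∈-++⁺ʳ (leaves l) (leavesAt-⊆ r p x∈)

shared-leaf⇒comparable : ∀ {A : Set} (T : BTree A) p q {x} → Unique (leaves T) →
                         x ∈ leavesAt T p → x ∈ leavesAt T q →
                         (∃[ r ] p ≡ q ++ r) ⊎ (∃[ r ] q ≡ p ++ r)
shared-leaf⇒comparable T [] q _ _ _ = inj₂ (q , refl)
shared-leaf⇒comparable T (b ∷ p) [] _ _ _ = inj₁ (b ∷ p , refl)
shared-leaf⇒comparable (node l r) (false ∷ p) (false ∷ q) unique x∈p x∈q
  with shared-leaf⇒comparable l p q (Unique-++⁻ˡ (leaves l) unique) x∈p x∈q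
... | inj₁ (s , e) = inj₁ (s , cong (false ∷_) e)
... | inj₂ (s , e) = inj₂ (s , cong (false ∷_) e)
shared-leaf⇒comparable (node l r) (true ∷ p) (true ∷ q) unique x∈p x∈q
  with shared-leaf⇒comparable r p q (Unique-++⁻ʳ (leaves l) unique) x∈p x∈q
... | inj₁ (s , e) = inj₁ (s , cong (true ∷_) e)
... | inj₂ (s , e) = inj₂ (s , cong (true ∷_) e)
shared-leaf⇒comparable (node l r) (false ∷ p) (true ∷ q) unique x∈p x∈q =
  ⊥-elim (Unique-++⇒disjoint (leaves l) unique (leavesAt-⊆ l p x∈p) (leavesAt-⊆ r q x∈q))
shared-leaf⇒comparable (node l r) (true ∷ p) (false ∷ q) unique x∈p x∈q =
  ⊥-elim (Unique-++⇒disjoint (leaves l) unique (leavesAt-⊆ l q x∈q) (leavesAt-⊆ r p x∈p))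

∈-L⇒∈-leavesAt : ∀ {n} (T : BTree (Fin n)) p {x} → x ∈ₛ L T p → x ∈ leavesAt T p
∈-L⇒∈-leavesAt T p x∈ with subAt T p
... | nothing = ⊥-elim (∉⊥ x∈)
... | just t  = ∈-leafSet (leaves t) x∈
  where
  ∈-leafSet : ∀ xs {x} → x ∈ₛ foldr (λ v S → ⁅ v ⁆ ∪ S) ∅ xs → x ∈ xs
  ∈-leafSet []       x∈ = ⊥-elim (∉⊥ x∈)
  ∈-leafSet (y ∷ xs) x∈ with x∈p∪q⁻ ⁅ y ⁆ _ x∈
  ... | inj₁ x∈⁅y⁆ = here (x∈⁅y⁆⇒x≡y y x∈⁅y⁆)
  ... | inj₂ x∈xs  = there (∈-leafSet xs x∈xs)

leaves-unique : ∀ {n} {G : Graph n} (𝒯 : RootedRankDecomposition G) → Unique (leaves (tree 𝒯))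
leaves-unique {n} 𝒯 = Unique-resp-↭ (setoid (Fin n)) (↭⇒↭ₛ (↭-sym (bijective 𝒯))) (allFin⁺ n)

∷-as-∷ʳ : ∀ {A : Set} (b : A) r → ∃[ s ] ∃[ y ] b ∷ r ≡ s ∷ʳ y
∷-as-∷ʳ b []      = [] , b , refl
∷-as-∷ʳ b (c ∷ r) with ∷-as-∷ʳ c r
... | s , y , e = b ∷ s , y , cong (b ∷_) e

module _ {A : Set} {T : BTree A} {P : Path → Set} (prefix : IsPrefix T P) where

  prefix-ancestor : ∀ p s → P (p ++ s) → P p
  prefix-ancestor p []      Pps = subst P (++-identityʳ p) Pps
  prefix-ancestor p (x ∷ s) Pps =
    IsPrefix.parentIn prefix p x (prefix-ancestor (p ∷ʳ x) s (subst P (sym (++-assoc p (x ∷ []) s)) Pps))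

  -- The prefix neighbour of an appendix is its parent: a child in the prefix would put
  -- the appendix there too.
  appendix-ancestor : ∀ {a} t b r → Appendix T P a → a ≡ t ++ (b ∷ r) → P t
  appendix-ancestor {a} t b r (_ , a∉P , q , q∈P , inj₁ (b′ , q≡a∷b′)) _ =
    ⊥-elim (a∉P (IsPrefix.parentIn prefix a b′ (subst P q≡a∷b′ q∈P)))
  appendix-ancestor {a} t b r (_ , _ , q , q∈P , inj₂ (b′ , a≡q∷b′)) a≡t++b∷r
    with ∷-as-∷ʳ b r
  ... | s , y , b∷r≡s∷y = prefix-ancestor t s (subst P q≡t++s q∈P)
    where
    q≡t++s : q ≡ t ++ s
    q≡t++s = ∷ʳ-injectiveˡ q (t ++ s) (begin
      q ∷ʳ b′          ≡⟨ a≡q∷b′ ⟨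
      a                ≡⟨ a≡t++b∷r ⟩
      t ++ (b ∷ r)     ≡⟨ cong (t ++_) b∷r≡s∷y ⟩
      t ++ (s ∷ʳ y)    ≡⟨ ++-assoc t s (y ∷ []) ⟨
      (t ++ s) ∷ʳ y    ∎)
      where open ≡-Reasoning

  below-appendix : ∀ {a t x} → Unique (leaves T) → Appendix T P a → IsNode T t → ¬ P t →
                   x ∈ leavesAt T t → x ∈ leavesAt T a → DescendantOf T t a
  below-appendix {a} {t} unique a-appendix t-node t∉P x∈t x∈a
    with shared-leaf⇒comparable T t a unique x∈t x∈a
  ... | inj₁ (r , t≡a++r)       = t-node , r , t≡a++r
  ... | inj₂ ([] , a≡t++[])     =
    t-node , [] , trans (trans (sym (++-identityʳ t)) (sym a≡t++[])) (sym (++-identityʳ a))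
  ... | inj₂ (b ∷ r , a≡t++b∷r) = ⊥-elim (t∉P (appendix-ancestor t b r a-appendix a≡t++b∷r))

+-≤-<⇒< : ∀ {a u c l} → a + u ≤ c + l → c < u → a < l
+-≤-<⇒< {a} {u} {c} {l} a+u≤c+l c<u = +-cancelʳ-< c a l (begin-strict
  a + c   <⟨ +-monoʳ-< a c<u ⟩
  a + u   ≤⟨ a+u≤c+l ⟩
  c + l   ≡⟨ +-comm c l ⟩
  l + c   ∎)
  where open ≤-Reasoning

lemma5p4 : ∀ {n m} (G : Graph n) (𝒯 : RootedRankDecomposition G) (P : Path → Set)
           (k : ℕ) (f : Fin n → Fin m) →
           IsPrefix (tree 𝒯) P → Leafless (tree 𝒯) P → 1 ≤ k →
           IsKClosure G 𝒯 P k f → IsLinkedClosure G 𝒯 P f →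
           (i : Fin m) (t : Path) → IsNode (tree 𝒯) t → ¬ P t →
           Cuts (tree 𝒯) (part f i) t →
           cutrk G (part f i ∩ L (tree 𝒯) t) < cutrk G (L (tree 𝒯) t)
lemma5p4 {n} G 𝒯 P k f prefix _ _ (_ , in-appendix , _) linked i t t-node t∉P cuts@((x , x∈Lt∩C) , _)
  with in-appendix i
... | a , a-appendix , C⊆La =
  +-≤-<⇒< (CutRank.cutrk-submodular G C Lt) (proj₂ (linked i a a-appendix C⊆La) t t-below-a cuts)
  where
  C Lt : Subset n
  C = part f i
  Lt = L (tree 𝒯) t

  t-below-a : DescendantOf (tree 𝒯) t a
  t-below-a = below-appendix prefix (leaves-unique 𝒯) a-appendix t-node t∉P
                (∈-L⇒∈-leavesAt (tree 𝒯) t (proj₁ (x∈p∩q⁻ Lt C x∈Lt∩C)))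
                (∈-L⇒∈-leavesAt (tree 𝒯) a (C⊆La (proj₂ (x∈p∩q⁻ Lt C x∈Lt∩C))))
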